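{- Let $m$ be a positive square-free integer and $B$ a commutative algebra over $A=\mathbb{Z}/m\mathbb{Z}$ that is free of finite rank as an $A$-module. If $p>\mathrm{rk}_A(B)$ for all primes $p$ dividing $m$, then $\mathrm{Trad}(B/A)=\mathrm{nil}(B)$.
   Context: For commutative rings $A\subseteq B$ with $B$ free of finite rank over $A$, $\mathrm{Tr}_{B/A}:B\to A$ sends $b$ to the trace of the $A$-linear map $x\mapsto bx$ on $B$, and the trace radical is $\mathrm{Trad}(B/A)=\{x\in B:\mathrm{Tr}_{B/A}(xB)=0\}$. $\mathrm{nil}(B)$ is the ideal of nilpotent elements of $B$. -}

module Defs where

open import Level using (_⊔_)
open import Algebra.Bundles using (CommutativeRing)
open import Data.Nat using (ℕ; zero; suc)
import Data.Nat as ℕ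
import Data.Nat.Divisibility as ℕ
open import Data.Nat.Primality using (Prime)
open import Data.Integer using (ℤ; +_; -[1+_])
import Data.Integer as ℤ
import Data.Integer.Divisibility as ℤ
open import Data.Fin using (Fin)
open import Data.Product using (∃)
open import Relation.Nullary using (¬_)
import Algebra.Definitions.RawMonoid as RM

SquareFree : ℕ → Set
SquareFree m = ∀ p → Prime p → ¬ (p ℕ.* p ℕ.∣ m)

sumℤ : ∀ {n} → (Fin n → ℤ) → ℤ
sumℤ = RM.sum ℤ.+-0-rawMonoid

module _ {c ℓ} (B : CommutativeRing c ℓ) where
  open CommutativeRing B

  ιℤ : ℤ → Carrier
  ιℤ (+ n)     = RM._×_ +-rawMonoid n 1#
  ιℤ -[1+ n ]  = - (RM._×_ +-rawMonoid (suc n) 1#)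

  -- scalar action of ℤ (hence of A = ℤ/mℤ, via representatives) on B
  _·_ : ℤ → Carrier → Carrier
  z · b = ιℤ z * b

  sumB : ∀ {n} → (Fin n → Carrier) → Carrier
  sumB = RM.sum +-rawMonoid

  lincomb : ∀ {n} → (Fin n → ℤ) → (Fin n → Carrier) → Carrier
  lincomb a e = sumB (λ i → a i · e i)

  -- B is an algebra over A = ℤ/mℤ: m · 1 = 0 in B
  IsAlgebraOverZmod : ℕ → Set ℓ
  IsAlgebraOverZmod m = ιℤ (+ m) ≈ 0#

  -- Elements of A are represented by
  -- integers (taken modulo m); coord b i is (a representative of) the i-th
  -- coordinate of b.
  record FreeBasis (m n : ℕ) : Set (c ⊔ ℓ) where
    field
      e      : Fin n → Carrier
      coord  : Carrier → Fin n → ℤ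
      spans  : ∀ b → b ≈ lincomb (coord b) e
      indep  : ∀ (a : Fin n → ℤ) → lincomb a e ≈ 0# → ∀ i → (+ m) ℤ.∣ a i

  module _ {m n : ℕ} (β : FreeBasis m n) where
    open FreeBasis β

    -- Tr_{B/A}(b) = trace of x ↦ b x, i.e. Σᵢ (i-th coordinate of b eᵢ);
    -- an integer representative of an element of ℤ/mℤ.
    Tr : Carrier → ℤ
    Tr b = sumℤ (λ i → coord (b * e i) i)

    InTrad : Carrier → Set (c)
    InTrad x = ∀ y → (+ m) ℤ.∣ Tr (x * y)

  pow : Carrier → ℕ → Carrier
  pow x zero    = 1#
  pow x (suc k) = x * pow x k

  IsNilpotent : Carrier → Set ℓ
  IsNilpotent x = ∃ λ k → pow x k ≈ 0#

-- Fix a prime p ∣ m. Modulo p, B is an n-dimensional algebra over the field ℤ/pℤ and Tr b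
-- reduces to the trace of the matrix of multiplication by b.
--   * If x is nilpotent, so is the matrix of x y, and a nilpotent matrix has trace 0.
--   * If x ∈ Trad, the n + 1 powers 1, x, …, xⁿ are dependent mod p; solving for the lowest
--     term gives xʲ = xʲ x g with j ≤ n. Then e = (x g)ʲ⁺¹ is idempotent with xʲ e = xʲ, and
--     Tr e = Tr (x ⋯) ≡ 0. The trace of an idempotent is its rank, a number ≤ n < p, so e ≡ 0
--     and hence xⁿ ≡ 0.
-- All linear algebra over ℤ/pℤ comes from a rank factorisation M = A C with L A = 1 and
-- C R = 1, which gives tr M = tr (C A). As m is squarefree, divisibility by every prime p ∣ m
-- is divisibility by m.
module Submission where

open import Defs
open import Algebra.Bundles using (CommutativeRing)
open import Data.Nat as ℕ using (ℕ; zero; suc; _<_; _≤_; z≤n; s≤s)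
import Data.Nat.Properties as ℕP
open import Data.Nat.Divisibility using (_∣_)
open import Data.Nat.Primality using (Prime)
open import Data.Fin using (Fin; zero; suc; toℕ)
open import Data.Integer as ℤ using (ℤ; +_)
import Data.Integer.Properties as ℤP
import Data.Integer.Divisibility as ℤᵤ
open import Data.Integer.Divisibility.Signed as ℤ∣ using (divides; ∣ᵤ⇒∣; ∣⇒∣ᵤ) renaming (_∣_ to _∣ℤ_)
open import Data.Product using (∃; _×_; _,_; proj₁; proj₂)
open import Data.Empty using (⊥-elim)
open import Level using (_⊔_)
open import Relation.Nullary using (¬_; Dec; yes; no)
open import Relation.Binary.PropositionalEquality as ≡ using (_≡_)

module Matrices {c ℓ} (R : CommutativeRing c ℓ) where
  open import Data.Vec.Functional using (Vector)
  open import Relation.Binary.Bundles using (Setoid)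
  open CommutativeRing R hiding (zero)
  open import Algebra.Properties.Semiring.Sum semiring public
    using (sum; sum-cong-≋; ∑-comm; ∑-distrib-+; *-distribˡ-sum; *-distribʳ-sum; sum-replicate-zero)
  import Algebra.Definitions.RawMonoid +-rawMonoid as Additive
  open import Algebra.Properties.Ring ring using (-0#≈0#)
  open import Algebra.Properties.AbelianGroup +-abelianGroup using (⁻¹-∙-comm)
  open import Relation.Binary.Reasoning.Setoid setoid
  import Relation.Binary.Reasoning.Setoid as SetoidReasoning

  fromℕ : ℕ → Carrier
  fromℕ k = k Additive.× 1#

  CharacteristicAbove : ℕ → Set ℓ
  CharacteristicAbove n = ∀ k → 0 < k → k ≤ n → ¬ fromℕ k ≈ 0#

  Matrix : ℕ → ℕ → Set c
  Matrix n m = Fin n → Fin m → Carrier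

  private variable
    n m k l : ℕ

  infix 4 _≋_
  _≋_ : Matrix n m → Matrix n m → Set ℓ
  A ≋ B = ∀ i j → A i j ≈ B i j

  ≋-setoid : ℕ → ℕ → Setoid c ℓ
  ≋-setoid n m = record
    { Carrier = Matrix n m
    ; _≈_ = _≋_
    ; isEquivalence = record
      { refl = λ i j → refl
      ; sym = λ A≋B i j → sym (A≋B i j)
      ; trans = λ A≋B B≋C i j → trans (A≋B i j) (B≋C i j)
      }
    }

  module ≋-Reasoning {n m : ℕ} = SetoidReasoning (≋-setoid n m)

  ≋-refl : {A : Matrix n m} → A ≋ A
  ≋-refl = Setoid.refl (≋-setoid _ _)

  ≋-sym : {A B : Matrix n m} → A ≋ B → B ≋ A
  ≋-sym = Setoid.sym (≋-setoid _ _)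

  ≋-trans : {A B C : Matrix n m} → A ≋ B → B ≋ C → A ≋ C
  ≋-trans = Setoid.trans (≋-setoid _ _)

  0M : Matrix n m
  0M _ _ = 0#

  1M : Matrix n n
  1M zero    zero    = 1#
  1M zero    (suc j) = 0#
  1M (suc i) zero    = 0#
  1M (suc i) (suc j) = 1M i j

  infixl 7 _⊗_
  _⊗_ : Matrix n k → Matrix k m → Matrix n m
  (A ⊗ B) i j = sum λ l → A i l * B l j

  infixr 8 _⊗^_
  _⊗^_ : Matrix n n → ℕ → Matrix n n
  A ⊗^ zero  = 1M
  A ⊗^ suc k = A ⊗ A ⊗^ k

  tr : Matrix n n → Carrier
  tr A = sum λ i → A i i

  sum-0 : {f : Vector Carrier n} → (∀ i → f i ≈ 0#) → sum f ≈ 0#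
  sum-0 {n} f≈0 = trans (sum-cong-≋ f≈0) (sum-replicate-zero n)

  ∑-zeroˡ : (f : Vector Carrier n) → sum (λ j → 0# * f j) ≈ 0#
  ∑-zeroˡ f = sum-0 λ j → zeroˡ (f j)

  ∑-neg : (f : Vector Carrier n) → sum (λ j → - f j) ≈ - sum f
  ∑-neg {zero}  f = sym -0#≈0#
  ∑-neg {suc n} f = trans (+-congˡ (∑-neg (λ j → f (suc j)))) (⁻¹-∙-comm (f zero) _)

  ∑-sub : (f g : Vector Carrier n) → sum (λ j → f j - g j) ≈ sum f - sum g
  ∑-sub f g = trans (∑-distrib-+ f (λ j → - g j)) (+-congˡ (∑-neg g))

  sum-1Mˡ : ∀ (i : Fin n) (f : Vector Carrier n) → sum (λ j → 1M i j * f j) ≈ f i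
  sum-1Mˡ zero f = begin
    1# * f zero + sum (λ j → 0# * f (suc j)) ≈⟨ +-cong (*-identityˡ _) (∑-zeroˡ (λ j → f (suc j))) ⟩
    f zero + 0#                              ≈⟨ +-identityʳ _ ⟩
    f zero                                   ∎
  sum-1Mˡ (suc i) f = begin
    0# * f zero + sum (λ j → 1M i j * f (suc j)) ≈⟨ +-cong (zeroˡ _) (sum-1Mˡ i (λ j → f (suc j))) ⟩
    0# + f (suc i)                               ≈⟨ +-identityˡ _ ⟩
    f (suc i)                                    ∎

  1M-sym : ∀ (i j : Fin n) → 1M i j ≈ 1M j i
  1M-sym zero    zero    = refl
  1M-sym zero    (suc j) = refl
  1M-sym (suc i) zero    = refl
  1M-sym (suc i) (suc j) = 1M-sym i j

  sum-1Mʳ : ∀ (j : Fin n) (f : Vector Carrier n) → sum (λ i → f i * 1M i j) ≈ f j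
  sum-1Mʳ j f = trans (sum-cong-≋ λ i → trans (*-comm (f i) _) (*-congʳ (1M-sym i j))) (sum-1Mˡ j f)

  ⊗-cong : {A A′ : Matrix n k} {B B′ : Matrix k m} → A ≋ A′ → B ≋ B′ → A ⊗ B ≋ A′ ⊗ B′
  ⊗-cong A≋A′ B≋B′ i j = sum-cong-≋ λ l → *-cong (A≋A′ i l) (B≋B′ l j)

  ⊗-congˡ : {A : Matrix n k} {B B′ : Matrix k m} → B ≋ B′ → A ⊗ B ≋ A ⊗ B′
  ⊗-congˡ = ⊗-cong ≋-refl

  ⊗-congʳ : {A A′ : Matrix n k} {B : Matrix k m} → A ≋ A′ → A ⊗ B ≋ A′ ⊗ B
  ⊗-congʳ A≋A′ = ⊗-cong A≋A′ ≋-refl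

  ⊗-assoc : (A : Matrix n k) (B : Matrix k l) (C : Matrix l m) → (A ⊗ B) ⊗ C ≋ A ⊗ (B ⊗ C)
  ⊗-assoc A B C i j = begin
    sum (λ b → sum (λ a → A i a * B a b) * C b j)
      ≈⟨ sum-cong-≋ (λ b → *-distribʳ-sum (C b j) (λ a → A i a * B a b)) ⟩
    sum (λ b → sum (λ a → A i a * B a b * C b j))
      ≈⟨ ∑-comm (λ b a → A i a * B a b * C b j) ⟩
    sum (λ a → sum (λ b → A i a * B a b * C b j))
      ≈⟨ sum-cong-≋ (λ a → sum-cong-≋ λ b → *-assoc (A i a) (B a b) (C b j)) ⟩
    sum (λ a → sum (λ b → A i a * (B a b * C b j)))
      ≈⟨ sum-cong-≋ (λ a → *-distribˡ-sum (A i a) (λ b → B a b * C b j)) ⟨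
    sum (λ a → A i a * sum (λ b → B a b * C b j))
      ∎

  ⊗-identityˡ : (A : Matrix n m) → 1M ⊗ A ≋ A
  ⊗-identityˡ A i j = sum-1Mˡ i (λ l → A l j)

  ⊗-identityʳ : (A : Matrix n m) → A ⊗ 1M ≋ A
  ⊗-identityʳ A i j = sum-1Mʳ j (A i)

  ⊗-zeroˡ : (A : Matrix k m) → 0M {n} ⊗ A ≋ 0M
  ⊗-zeroˡ A i j = sum-0 λ l → zeroˡ (A l j)

  ⊗-zeroʳ : (A : Matrix n k) → A ⊗ 0M {k} {m} ≋ 0M
  ⊗-zeroʳ A i j = sum-0 λ l → zeroʳ (A i l)

  tr-cong : {A B : Matrix n n} → A ≋ B → tr A ≈ tr B
  tr-cong A≋B = sum-cong-≋ λ i → A≋B i i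

  tr-⊗-comm : (A : Matrix n k) (B : Matrix k n) → tr (A ⊗ B) ≈ tr (B ⊗ A)
  tr-⊗-comm A B = trans (∑-comm (λ i l → A i l * B l i)) (sum-cong-≋ λ l → sum-cong-≋ λ i → *-comm (A i l) (B l i))

  tr-1M : ∀ r → tr (1M {r}) ≈ fromℕ r
  tr-1M zero    = refl
  tr-1M (suc r) = +-congˡ (tr-1M r)

  tr-0M : tr (0M {n}) ≈ 0#
  tr-0M {n} = sum-replicate-zero n


record IsDiscreteField {c ℓ} (K : CommutativeRing c ℓ) : Set (c ⊔ ℓ) where
  open CommutativeRing K
  field
    _≟0     : ∀ a → Dec (a ≈ 0#)
    inverse : ∀ {a} → ¬ a ≈ 0# → ∃ λ u → u * a ≈ 1#
    1≉0     : ¬ 1# ≈ 0#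

module LinearAlgebra {c ℓ} (K : CommutativeRing c ℓ) (isDiscreteField : IsDiscreteField K) where
  open CommutativeRing K hiding (zero)
  open IsDiscreteField isDiscreteField
  open import Data.Nat using (_∸_)
  open import Data.Fin.Properties using (any?)
  open import Data.Vec.Functional using (Vector; _∷_)
  open import Data.Sum using (_⊎_; inj₁; inj₂; [_,_]′)
  open import Function using (id)
  open import Relation.Nullary using (¬?)
  open import Relation.Nullary.Decidable using (decidable-stable)
  open import Relation.Binary.PropositionalEquality using (_≢_)

  open Matrices K
  open import Algebra.Properties.Ring ring using (-‿distribʳ-*; -0#≈0#; x[y-z]≈xy-xz; [y-z]x≈yx-zx)
  open import Algebra.Properties.Group +-group
    using (x∙y⁻¹≈ε⇒x≈y; x≈y⇒x∙y⁻¹≈ε; //-rightDividesˡ; identityˡ-unique)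
  open import Algebra.Properties.Monoid.Mult +-monoid using (×-homo-+)
  import Relation.Binary.Reasoning.Setoid setoid as ≈-Reasoning

  private variable
    n m k : ℕ

  infixl 7 _⊗ᵛ_
  _⊗ᵛ_ : Matrix n m → Vector Carrier m → Vector Carrier n
  (A ⊗ᵛ v) i = sum λ j → A i j * v j

  private
    column : Vector Carrier n → Matrix n 1
    column v i _ = v i

  ⊗ᵛ-cong : {A A′ : Matrix n m} {v v′ : Vector Carrier m} →
            A ≋ A′ → (∀ j → v j ≈ v′ j) → ∀ i → (A ⊗ᵛ v) i ≈ (A′ ⊗ᵛ v′) i
  ⊗ᵛ-cong {v = v} {v′} A≋A′ v≈v′ i = ⊗-cong {B = column v} {column v′} A≋A′ (λ j _ → v≈v′ j) i zero

  ⊗ᵛ-assoc : (A : Matrix n k) (B : Matrix k m) (v : Vector Carrier m) →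
             ∀ i → ((A ⊗ B) ⊗ᵛ v) i ≈ (A ⊗ᵛ (B ⊗ᵛ v)) i
  ⊗ᵛ-assoc A B v i = ⊗-assoc A B (column v) i zero

  ⊗ᵛ-identity : (v : Vector Carrier n) → ∀ i → (1M ⊗ᵛ v) i ≈ v i
  ⊗ᵛ-identity v i = sum-1Mˡ i v

  ⊗ᵛ-zero : (A : Matrix n m) {v : Vector Carrier m} → (∀ j → v j ≈ 0#) → ∀ i → (A ⊗ᵛ v) i ≈ 0#
  ⊗ᵛ-zero A v≈0 i = sum-0 λ j → trans (*-congˡ (v≈0 j)) (zeroʳ (A i j))

  ⊗ᵛ-neg : (A : Matrix n m) (v : Vector Carrier m) → ∀ i → (A ⊗ᵛ (λ j → - v j)) i ≈ - (A ⊗ᵛ v) i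
  ⊗ᵛ-neg A v i = trans (sum-cong-≋ λ j → sym (-‿distribʳ-* (A i j) (v j))) (∑-neg (λ j → A i j * v j))

  ⊗ᵛ-sub : (A : Matrix n m) (v w : Vector Carrier m) →
           ∀ i → (A ⊗ᵛ (λ j → v j - w j)) i ≈ (A ⊗ᵛ v) i - (A ⊗ᵛ w) i
  ⊗ᵛ-sub A v w i =
    trans (sum-cong-≋ λ j → x[y-z]≈xy-xz (A i j) (v j) (w j)) (∑-sub (λ j → A i j * v j) (λ j → A i j * w j))

  NonTrivialKernel : Matrix n m → Set (c ⊔ ℓ)
  NonTrivialKernel {m = m} M = ∃ λ (v : Vector Carrier m) → (∃ λ j → ¬ v j ≈ 0#) × (∀ i → (M ⊗ᵛ v) i ≈ 0#)

  record RankFactorisation (M : Matrix n m) : Set (c ⊔ ℓ) where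
    field
      rank   : ℕ
      rank≤m : rank ≤ m
      A      : Matrix n rank
      C      : Matrix rank m
      L      : Matrix rank n
      R      : Matrix m rank
      M≋AC   : M ≋ A ⊗ C
      LA≋1   : L ⊗ A ≋ 1M
      CR≋1   : C ⊗ R ≋ 1M
      full-or-kernel : rank ≡ m ⊎ NonTrivialKernel M

    sandwich : (X : Matrix rank rank) → L ⊗ (A ⊗ X ⊗ C) ⊗ R ≋ X
    sandwich X = begin
      L ⊗ (A ⊗ X ⊗ C) ⊗ R     ≈⟨ ⊗-assoc L (A ⊗ X ⊗ C) R ⟩
      L ⊗ (A ⊗ X ⊗ C ⊗ R)     ≈⟨ ⊗-congˡ (⊗-assoc (A ⊗ X) C R) ⟩
      L ⊗ (A ⊗ X ⊗ (C ⊗ R))   ≈⟨ ⊗-congˡ (⊗-congˡ {A = A ⊗ X} CR≋1) ⟩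
      L ⊗ (A ⊗ X ⊗ 1M)        ≈⟨ ⊗-congˡ (⊗-identityʳ (A ⊗ X)) ⟩
      L ⊗ (A ⊗ X)             ≈⟨ ⊗-assoc L A X ⟨
      L ⊗ A ⊗ X               ≈⟨ ⊗-congʳ LA≋1 ⟩
      1M ⊗ X                  ≈⟨ ⊗-identityˡ X ⟩
      X                       ∎
      where open ≋-Reasoning

    cancel : {X Y : Matrix rank rank} → A ⊗ X ⊗ C ≋ A ⊗ Y ⊗ C → X ≋ Y
    cancel {X} {Y} AXC≋AYC = begin
      X                       ≈⟨ sandwich X ⟨
      L ⊗ (A ⊗ X ⊗ C) ⊗ R     ≈⟨ ⊗-congʳ (⊗-congˡ AXC≋AYC) ⟩
      L ⊗ (A ⊗ Y ⊗ C) ⊗ R     ≈⟨ sandwich Y ⟩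
      Y                       ∎
      where open ≋-Reasoning

  private module _ {n m : ℕ} (M : Matrix n (suc m)) (F : RankFactorisation (λ i j → M i (suc j))) where
    open RankFactorisation F renaming (rank to r; A to A₀; C to C₀; L to L₀; R to R₀)

    c₀ : Vector Carrier n
    c₀ i = M i zero

    M₀ : Matrix n m
    M₀ i j = M i (suc j)

    ℓ₀ : Vector Carrier r
    ℓ₀ = L₀ ⊗ᵛ c₀

    d : Vector Carrier n
    d i = c₀ i - (A₀ ⊗ᵛ ℓ₀) i

    L₀d≈0 : ∀ k → (L₀ ⊗ᵛ d) k ≈ 0#
    L₀d≈0 k = begin
      (L₀ ⊗ᵛ d) k                     ≈⟨ ⊗ᵛ-sub L₀ c₀ (A₀ ⊗ᵛ ℓ₀) k ⟩
      ℓ₀ k - (L₀ ⊗ᵛ (A₀ ⊗ᵛ ℓ₀)) k      ≈⟨ +-congˡ (-‿cong (⊗ᵛ-assoc L₀ A₀ ℓ₀ k)) ⟨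
      ℓ₀ k - ((L₀ ⊗ A₀) ⊗ᵛ ℓ₀) k       ≈⟨ +-congˡ (-‿cong (⊗ᵛ-cong LA≋1 (λ _ → refl) k)) ⟩
      ℓ₀ k - (1M ⊗ᵛ ℓ₀) k              ≈⟨ x≈y⇒x∙y⁻¹≈ε (sym (⊗ᵛ-identity ℓ₀ k)) ⟩
      0#                              ∎
      where open ≈-Reasoning

    M₀R₀≋A₀ : M₀ ⊗ R₀ ≋ A₀
    M₀R₀≋A₀ = begin
      M₀ ⊗ R₀         ≈⟨ ⊗-congʳ M≋AC ⟩
      (A₀ ⊗ C₀) ⊗ R₀   ≈⟨ ⊗-assoc A₀ C₀ R₀ ⟩
      A₀ ⊗ (C₀ ⊗ R₀)   ≈⟨ ⊗-congˡ CR≋1 ⟩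
      A₀ ⊗ 1M         ≈⟨ ⊗-identityʳ A₀ ⟩
      A₀              ∎
      where open ≋-Reasoning

    apply-1∷-R₀ℓ₀ : ∀ {k} (X : Matrix k m) (x : Vector Carrier k) → ∀ i →
      x i * 1# + (X ⊗ᵛ (λ j → - (R₀ ⊗ᵛ ℓ₀) j)) i ≈ x i - ((X ⊗ R₀) ⊗ᵛ ℓ₀) i
    apply-1∷-R₀ℓ₀ X x i = +-cong (*-identityʳ (x i)) (trans (⊗ᵛ-neg X (R₀ ⊗ᵛ ℓ₀) i) (-‿cong (sym (⊗ᵛ-assoc X R₀ ℓ₀ i))))

    extend-dependent : (∀ i → d i ≈ 0#) → RankFactorisation M
    extend-dependent d≈0 = record
      { rank = r ; rank≤m = ℕP.m≤n⇒m≤1+n rank≤m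
      ; A = A₀ ; C = λ k → ℓ₀ k ∷ C₀ k ; L = L₀ ; R = (λ _ → 0#) ∷ R₀
      ; M≋AC = M≋AC′ ; LA≋1 = LA≋1
      ; CR≋1 = λ k k′ → trans (+-cong (zeroʳ (ℓ₀ k)) refl) (trans (+-identityˡ _) (CR≋1 k k′))
      ; full-or-kernel = inj₂ (1# ∷ (λ j → - (R₀ ⊗ᵛ ℓ₀) j) , (zero , 1≉0) , kernel)
      }
      where
      M≋AC′ : M ≋ A₀ ⊗ (λ k → ℓ₀ k ∷ C₀ k)
      M≋AC′ i zero    = x∙y⁻¹≈ε⇒x≈y _ _ (d≈0 i)
      M≋AC′ i (suc j) = M≋AC i j
      kernel : ∀ i → (M ⊗ᵛ (1# ∷ (λ j → - (R₀ ⊗ᵛ ℓ₀) j))) i ≈ 0#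
      kernel i = begin
        c₀ i * 1# + (M₀ ⊗ᵛ (λ j → - (R₀ ⊗ᵛ ℓ₀) j)) i ≈⟨ apply-1∷-R₀ℓ₀ M₀ c₀ i ⟩
        c₀ i - ((M₀ ⊗ R₀) ⊗ᵛ ℓ₀) i                   ≈⟨ +-congˡ (-‿cong (⊗ᵛ-cong M₀R₀≋A₀ (λ _ → refl) i)) ⟩
        d i                                           ≈⟨ d≈0 i ⟩
        0#                                            ∎
        where open ≈-Reasoning

    extend-independent : ∀ i₀ → ¬ d i₀ ≈ 0# → RankFactorisation M
    extend-independent i₀ d≉0 = record
      { rank = suc r ; rank≤m = s≤s rank≤m
      ; A = A ; C = C ; L = ψ ∷ L₀ ; R = R
      ; M≋AC = M≋AC′ ; LA≋1 = LA≋1′ ; CR≋1 = CR≋1′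
      ; full-or-kernel = extend-kernel full-or-kernel
      }
      where
      open ≈-Reasoning
      u = proj₁ (inverse d≉0)
      ud≈1 = proj₂ (inverse d≉0)

      A : Matrix n (suc r)
      A i = d i ∷ A₀ i

      C : Matrix (suc r) (suc m)
      C = (1# ∷ λ _ → 0#) ∷ λ k → ℓ₀ k ∷ C₀ k

      R : Matrix (suc m) (suc r)
      R = (1# ∷ λ _ → 0#) ∷ λ j → - (R₀ ⊗ᵛ ℓ₀) j ∷ R₀ j

      P : Matrix n n
      P = A₀ ⊗ L₀

      -- ψ is u times the i₀-th row of 1M - P, which kills the columns of A₀ and sends d to 1
      ψ : Vector Carrier n
      ψ l = u * (1M i₀ l - P i₀ l)

      ψ-apply : ∀ w → sum (λ l → ψ l * w l) ≈ u * (w i₀ - (P ⊗ᵛ w) i₀)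
      ψ-apply w = begin
        sum (λ l → u * (1M i₀ l - P i₀ l) * w l)                ≈⟨ sum-cong-≋ (λ l → *-assoc u _ (w l)) ⟩
        sum (λ l → u * ((1M i₀ l - P i₀ l) * w l))              ≈⟨ *-distribˡ-sum u (λ l → (1M i₀ l - P i₀ l) * w l) ⟨
        u * sum (λ l → (1M i₀ l - P i₀ l) * w l)                ≈⟨ *-congˡ (sum-cong-≋ λ l → [y-z]x≈yx-zx (w l) _ _) ⟩
        u * sum (λ l → 1M i₀ l * w l - P i₀ l * w l)            ≈⟨ *-congˡ (∑-sub (λ l → 1M i₀ l * w l) (λ l → P i₀ l * w l)) ⟩
        u * (sum (λ l → 1M i₀ l * w l) - (P ⊗ᵛ w) i₀)           ≈⟨ *-congˡ (+-congʳ (sum-1Mˡ i₀ w)) ⟩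
        u * (w i₀ - (P ⊗ᵛ w) i₀)                                ∎

      M≋AC′ : M ≋ A ⊗ C
      M≋AC′ i zero    = sym (trans (+-congʳ (*-identityʳ (d i))) (//-rightDividesˡ _ (c₀ i)))
      M≋AC′ i (suc j) = trans (M≋AC i j) (sym (trans (+-congʳ (zeroʳ (d i))) (+-identityˡ _)))

      LA≋1′ : (ψ ∷ L₀) ⊗ A ≋ 1M
      LA≋1′ zero zero = begin
        sum (λ l → ψ l * d l)       ≈⟨ ψ-apply d ⟩
        u * (d i₀ - (P ⊗ᵛ d) i₀)    ≈⟨ *-congˡ (+-congˡ (-‿cong (trans (⊗ᵛ-assoc A₀ L₀ d i₀) (⊗ᵛ-zero A₀ L₀d≈0 i₀)))) ⟩
        u * (d i₀ - 0#)             ≈⟨ *-congˡ (trans (+-congˡ -0#≈0#) (+-identityʳ (d i₀))) ⟩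
        u * d i₀                    ≈⟨ ud≈1 ⟩
        1#                          ∎
      LA≋1′ zero (suc k) = begin
        sum (λ l → ψ l * A₀ l k)                        ≈⟨ ψ-apply (λ l → A₀ l k) ⟩
        u * (A₀ i₀ k - (P ⊗ᵛ (λ l → A₀ l k)) i₀)        ≈⟨ *-congˡ (x≈y⇒x∙y⁻¹≈ε (sym PA₀≋A₀)) ⟩
        u * 0#                                          ≈⟨ zeroʳ u ⟩
        0#                                              ∎
        where
        PA₀≋A₀ : (P ⊗ A₀) i₀ k ≈ A₀ i₀ k
        PA₀≋A₀ = trans (⊗-assoc A₀ L₀ A₀ i₀ k) (trans (⊗-congˡ {A = A₀} LA≋1 i₀ k) (⊗-identityʳ A₀ i₀ k))
      LA≋1′ (suc k) zero    = L₀d≈0 k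
      LA≋1′ (suc k) (suc l) = LA≋1 k l

      CR≋1′ : C ⊗ R ≋ 1M
      CR≋1′ zero    zero    = trans (+-cong (*-identityʳ 1#) (∑-zeroˡ (λ j → - (R₀ ⊗ᵛ ℓ₀) j))) (+-identityʳ 1#)
      CR≋1′ zero    (suc l) = trans (+-cong (zeroʳ 1#) (∑-zeroˡ (λ j → R₀ j l))) (+-identityˡ 0#)
      CR≋1′ (suc k) zero    = begin
        ℓ₀ k * 1# + (C₀ ⊗ᵛ (λ j → - (R₀ ⊗ᵛ ℓ₀) j)) k ≈⟨ apply-1∷-R₀ℓ₀ C₀ ℓ₀ k ⟩
        ℓ₀ k - ((C₀ ⊗ R₀) ⊗ᵛ ℓ₀) k
          ≈⟨ x≈y⇒x∙y⁻¹≈ε (sym (trans (⊗ᵛ-cong CR≋1 (λ _ → refl) k) (⊗ᵛ-identity ℓ₀ k))) ⟩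
        0#                                           ∎
      CR≋1′ (suc k) (suc l) = trans (+-cong (zeroʳ (ℓ₀ k)) refl) (trans (+-identityˡ _) (CR≋1 k l))

      extend-kernel : r ≡ m ⊎ NonTrivialKernel M₀ → suc r ≡ suc m ⊎ NonTrivialKernel M
      extend-kernel (inj₁ r≡m) = inj₁ (≡.cong suc r≡m)
      extend-kernel (inj₂ (v , (j , vj≉0) , M₀v≈0)) =
        inj₂ (0# ∷ v , (suc j , vj≉0) , λ i → trans (+-cong (zeroʳ (c₀ i)) refl) (trans (+-identityˡ _) (M₀v≈0 i)))

    extend : RankFactorisation M
    extend with any? (λ i → ¬? (d i ≟0))
    ... | yes (i₀ , d≉0) = extend-independent i₀ d≉0
    ... | no ∄d≉0        = extend-dependent λ i → decidable-stable (d i ≟0) λ d≉0 → ∄d≉0 (i , d≉0)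

  -- Gaussian elimination, one column at a time: the new column c₀ either lies in the span of A₀
  -- (the rank is unchanged and 1 ∷ - R₀ L₀ c₀ is a kernel vector) or its residual d = c₀ - A₀ L₀ c₀
  -- has an entry d i₀ ≉ 0, which becomes a new pivot.
  rankFactorisation : ∀ {n} m (M : Matrix n m) → RankFactorisation M
  rankFactorisation zero    M = record
    { rank = 0 ; rank≤m = z≤n ; A = λ _ () ; C = λ () ; L = λ () ; R = λ ()
    ; M≋AC = λ _ () ; LA≋1 = λ () ; CR≋1 = λ () ; full-or-kernel = inj₁ ≡.refl
    }
  rankFactorisation (suc m) M = extend M (rankFactorisation m (λ i j → M i (suc j)))

  idempotent-rank : {E : Matrix n n} → E ⊗ E ≋ E → ∃ λ r → r ≤ n × tr E ≈ fromℕ r × (r ≡ 0 → E ≋ 0M)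
  idempotent-rank {n} {E} E²≋E = rank , rank≤m , tr-E , rank≡0⇒E≋0
    where
    open RankFactorisation (rankFactorisation n E)

    CA≋1 : C ⊗ A ≋ 1M
    CA≋1 = cancel (begin
      A ⊗ (C ⊗ A) ⊗ C     ≈⟨ ⊗-congʳ (⊗-assoc A C A) ⟨
      A ⊗ C ⊗ A ⊗ C       ≈⟨ ⊗-assoc (A ⊗ C) A C ⟩
      (A ⊗ C) ⊗ (A ⊗ C)   ≈⟨ ⊗-cong M≋AC M≋AC ⟨
      E ⊗ E               ≈⟨ E²≋E ⟩
      E                   ≈⟨ M≋AC ⟩
      A ⊗ C               ≈⟨ ⊗-congʳ (⊗-identityʳ A) ⟨
      A ⊗ 1M ⊗ C          ∎)
      where open ≋-Reasoning

    tr-E : tr E ≈ fromℕ rank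
    tr-E = trans (tr-cong M≋AC) (trans (tr-⊗-comm A C) (trans (tr-cong CA≋1) (tr-1M rank)))

    rank≡0⇒E≋0 : rank ≡ 0 → E ≋ 0M
    rank≡0⇒E≋0 rank≡0 = ≋-trans M≋AC (⊗-through-0 A C rank≡0)
      where
      ⊗-through-0 : ∀ {r} (A : Matrix n r) (C : Matrix r n) → r ≡ 0 → A ⊗ C ≋ 0M
      ⊗-through-0 A C ≡.refl _ _ = refl

  -- With N = A C, N ^ (k + 1) = A (C A) ^ k C, so C A is nilpotent of lower order and tr N = tr (C A).
  tr-nilpotent : ∀ k (N : Matrix n n) → N ⊗^ k ≋ 0M → tr N ≈ 0#
  tr-nilpotent {n} zero N 1≋0 = trans (tr-cong N≋0) (tr-0M {n})
    where
    N≋0 : N ≋ 0M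
    N≋0 = ≋-trans (≋-sym (⊗-identityˡ N)) (≋-trans (⊗-congʳ 1≋0) (⊗-zeroˡ N))
  tr-nilpotent {n} (suc k) N Nᵏ⁺¹≋0 =
    trans (tr-cong M≋AC) (trans (tr-⊗-comm A C) (tr-nilpotent k (C ⊗ A) [CA]ᵏ≋0))
    where
    open RankFactorisation (rankFactorisation n N)

    power : ∀ j → N ⊗^ suc j ≋ A ⊗ (C ⊗ A) ⊗^ j ⊗ C
    power zero = begin
      N ⊗ 1M         ≈⟨ ⊗-identityʳ N ⟩
      N              ≈⟨ M≋AC ⟩
      A ⊗ C          ≈⟨ ⊗-congʳ (⊗-identityʳ A) ⟨
      A ⊗ 1M ⊗ C     ∎
      where open ≋-Reasoning
    power (suc j) = begin
      N ⊗ N ⊗^ suc j                            ≈⟨ ⊗-cong M≋AC (power j) ⟩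
      (A ⊗ C) ⊗ (A ⊗ X ⊗ C)                     ≈⟨ ⊗-assoc (A ⊗ C) (A ⊗ X) C ⟨
      (A ⊗ C) ⊗ (A ⊗ X) ⊗ C                     ≈⟨ ⊗-congʳ (⊗-assoc A C (A ⊗ X)) ⟩
      A ⊗ (C ⊗ (A ⊗ X)) ⊗ C                     ≈⟨ ⊗-congʳ (⊗-congˡ {A = A} (⊗-assoc C A X)) ⟨
      A ⊗ (C ⊗ A ⊗ X) ⊗ C                       ∎
      where
      open ≋-Reasoning
      X = (C ⊗ A) ⊗^ j

    [CA]ᵏ≋0 : (C ⊗ A) ⊗^ k ≋ 0M
    [CA]ᵏ≋0 = cancel (begin
      A ⊗ (C ⊗ A) ⊗^ k ⊗ C     ≈⟨ power k ⟨
      N ⊗^ suc k               ≈⟨ Nᵏ⁺¹≋0 ⟩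
      0M                       ≈⟨ ⊗-zeroˡ C ⟨
      0M ⊗ C                   ≈⟨ ⊗-congʳ (⊗-zeroʳ {m = rank} A) ⟨
      A ⊗ 0M ⊗ C               ∎)
      where open ≋-Reasoning

  idempotent-tr≈0⇒≋0 : CharacteristicAbove n → {E : Matrix n n} → E ⊗ E ≋ E → tr E ≈ 0# → E ≋ 0M
  idempotent-tr≈0⇒≋0 char E²≋E trE≈0 with idempotent-rank E²≋E
  ... | zero  , _ , _ , rank≡0⇒E≋0 = rank≡0⇒E≋0 ≡.refl
  ... | suc r , r<n , trE≈r , _     = ⊥-elim (char (suc r) (s≤s z≤n) r<n (trans (sym trE≈r) trE≈0))

  -- A L is an idempotent of trace tr (L A) = n + 1 whose rank is at most n.
  ¬wide-left-invertible : CharacteristicAbove n → (A : Matrix n (suc n)) (L : Matrix (suc n) n) → ¬ L ⊗ A ≋ 1M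
  ¬wide-left-invertible {n} char A L LA≋1 with idempotent-rank AL²≋AL
    where
    AL²≋AL : A ⊗ L ⊗ (A ⊗ L) ≋ A ⊗ L
    AL²≋AL = begin
      A ⊗ L ⊗ (A ⊗ L)     ≈⟨ ⊗-assoc (A ⊗ L) A L ⟨
      A ⊗ L ⊗ A ⊗ L       ≈⟨ ⊗-congʳ {B = L} (⊗-assoc A L A) ⟩
      A ⊗ (L ⊗ A) ⊗ L     ≈⟨ ⊗-congʳ {B = L} (⊗-congˡ {A = A} LA≋1) ⟩
      A ⊗ 1M ⊗ L          ≈⟨ ⊗-congʳ {B = L} (⊗-identityʳ A) ⟩
      A ⊗ L               ∎
      where open ≋-Reasoning
  ... | zero , _ , _ , rank≡0⇒AL≋0 = 1≉0 (1≋0 zero zero)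
    where
    1≋0 : 1M ≋ 0M
    1≋0 = begin
      1M                  ≈⟨ ⊗-identityˡ 1M ⟨
      1M ⊗ 1M             ≈⟨ ⊗-cong LA≋1 LA≋1 ⟨
      L ⊗ A ⊗ (L ⊗ A)     ≈⟨ ⊗-assoc (L ⊗ A) L A ⟨
      L ⊗ A ⊗ L ⊗ A       ≈⟨ ⊗-congʳ (⊗-assoc L A L) ⟩
      L ⊗ (A ⊗ L) ⊗ A     ≈⟨ ⊗-congʳ (⊗-congˡ {A = L} (rank≡0⇒AL≋0 ≡.refl)) ⟩
      L ⊗ 0M ⊗ A          ≈⟨ ⊗-congʳ {B = A} (⊗-zeroʳ L) ⟩
      0M ⊗ A              ≈⟨ ⊗-zeroˡ A ⟩
      0M                  ∎
      where open ≋-Reasoning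
  ... | suc r , r<n , trAL≈r , _ = char (n ∸ r) (ℕP.m<n⇒0<n∸m r<n) (ℕP.m∸n≤m n r) (identityˡ-unique _ _ (begin
      fromℕ (n ∸ r) + fromℕ (suc r)   ≈⟨ ×-homo-+ 1# (n ∸ r) (suc r) ⟨
      fromℕ (n ∸ r ℕ.+ suc r)         ≡⟨ ≡.cong fromℕ (ℕP.m∸n+n≡m {suc n} (ℕP.m≤n⇒m≤1+n r<n)) ⟩
      fromℕ (suc n)                   ≈⟨ tr-1M (suc n) ⟨
      tr (1M {suc n})                 ≈⟨ tr-cong LA≋1 ⟨
      tr (L ⊗ A)                      ≈⟨ tr-⊗-comm L A ⟩
      tr (A ⊗ L)                      ≈⟨ trAL≈r ⟩
      fromℕ (suc r)                   ∎))
    where open ≈-Reasoning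

  wide-kernel : CharacteristicAbove n → (M : Matrix n (suc n)) → NonTrivialKernel M
  wide-kernel {n} char M = [ (λ rank≡1+n → ⊥-elim (full-rank-impossible A L LA≋1 rank≡1+n)) , id ]′ full-or-kernel
    where
    open RankFactorisation (rankFactorisation (suc n) M)
    full-rank-impossible : ∀ {r} (A : Matrix n r) (L : Matrix r n) → L ⊗ A ≋ 1M → r ≢ suc n
    full-rank-impossible A L LA≋1 ≡.refl = ¬wide-left-invertible char A L LA≋1


record IsIdeal {c ℓ i} (R : CommutativeRing c ℓ) (I : CommutativeRing.Carrier R → Set i) : Set (c ⊔ ℓ ⊔ i) where
  open CommutativeRing R
  field
    ∈-resp-≈  : ∀ {a b} → a ≈ b → I a → I b
    0#∈       : I 0#
    +-closed  : ∀ {a b} → I a → I b → I (a + b)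
    *-closedˡ : ∀ r {a} → I a → I (r * a)

module Quotient {c ℓ i} (R : CommutativeRing c ℓ) {I : CommutativeRing.Carrier R → Set i} (ideal : IsIdeal R I) where
  open CommutativeRing R
  open IsIdeal ideal
  open import Algebra.Properties.Ring ring using (-1*x≈-x; x[y-z]≈xy-xz; [y-z]x≈yx-zx; -0#≈0#)
  open import Algebra.Properties.AbelianGroup +-abelianGroup using (⁻¹-anti-homo‿-; ⁻¹-∙-comm)
  open import Algebra.Properties.Group +-group using (x≈y⇒x∙y⁻¹≈ε)
  open import Algebra.Properties.CommutativeSemigroup +-commutativeSemigroup using (interchange)
  open import Relation.Binary.Reasoning.Setoid setoid

  -‿closed : ∀ {a} → I a → I (- a)
  -‿closed Ia = ∈-resp-≈ (-1*x≈-x _) (*-closedˡ (- 1#) Ia)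

  -- A record rather than I (a - b), so that a and b can be inferred from a proof of a ∼ b.
  infix 4 _∼_
  record _∼_ (a b : Carrier) : Set i where
    constructor mk∼
    field ∈I : I (a - b)
  open _∼_ public

  ≈⇒∼ : ∀ {a b} → a ≈ b → a ∼ b
  ≈⇒∼ a≈b = mk∼ (∈-resp-≈ (sym (x≈y⇒x∙y⁻¹≈ε a≈b)) 0#∈)

  ∼0⇒∈ : ∀ {a} → a ∼ 0# → I a
  ∼0⇒∈ (mk∼ a-0∈I) = ∈-resp-≈ (trans (+-congˡ -0#≈0#) (+-identityʳ _)) a-0∈I

  ∼-sym : ∀ {a b} → a ∼ b → b ∼ a
  ∼-sym {a} {b} (mk∼ a-b∈I) = mk∼ (∈-resp-≈ (⁻¹-anti-homo‿- a b) (-‿closed a-b∈I))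

  ∼-trans : ∀ {a b c} → a ∼ b → b ∼ c → a ∼ c
  ∼-trans {a} {b} {c} (mk∼ a-b∈I) (mk∼ b-c∈I) = mk∼ (∈-resp-≈ telescope (+-closed a-b∈I b-c∈I))
    where
    telescope : (a - b) + (b - c) ≈ a - c
    telescope = begin
      (a - b) + (b - c)     ≈⟨ +-assoc a (- b) (b - c) ⟩
      a + (- b + (b - c))   ≈⟨ +-congˡ (+-assoc (- b) b (- c)) ⟨
      a + ((- b + b) - c)   ≈⟨ +-congˡ (+-congʳ (-‿inverseˡ b)) ⟩
      a + (0# - c)          ≈⟨ +-congˡ (+-identityˡ (- c)) ⟩
      a - c                 ∎

  ∼-+-cong : ∀ {a b c d} → a ∼ b → c ∼ d → a + c ∼ b + d
  ∼-+-cong {a} {b} {c} {d} (mk∼ a-b∈I) (mk∼ c-d∈I) =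
    mk∼ (∈-resp-≈ (trans (interchange a (- b) c (- d)) (+-congˡ (⁻¹-∙-comm b d))) (+-closed a-b∈I c-d∈I))

  ∼-*-cong : ∀ {a b c d} → a ∼ b → c ∼ d → a * c ∼ b * d
  ∼-*-cong {a} {b} {c} {d} (mk∼ a-b∈I) (mk∼ c-d∈I) = ∼-trans ac∼bc bc∼bd
    where
    ac∼bc : a * c ∼ b * c
    ac∼bc = mk∼ (∈-resp-≈ (trans (*-comm c (a - b)) ([y-z]x≈yx-zx c a b)) (*-closedˡ c a-b∈I))
    bc∼bd : b * c ∼ b * d
    bc∼bd = mk∼ (∈-resp-≈ (x[y-z]≈xy-xz b c d) (*-closedˡ b c-d∈I))

  ∼-‿cong : ∀ {a b} → a ∼ b → - a ∼ - b
  ∼-‿cong {a} {b} (mk∼ a-b∈I) = mk∼ (∈-resp-≈ (sym (⁻¹-∙-comm a (- b))) (-‿closed a-b∈I))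

  quotientRing : CommutativeRing c i
  quotientRing = record
    { Carrier = Carrier ; _≈_ = _∼_ ; _+_ = _+_ ; _*_ = _*_ ; -_ = -_ ; 0# = 0# ; 1# = 1#
    ; isCommutativeRing = record
      { isRing = record
        { +-isAbelianGroup = record
          { isGroup = record
            { isMonoid = record
              { isSemigroup = record
                { isMagma = record
                  { isEquivalence = record { refl = ≈⇒∼ refl ; sym = ∼-sym ; trans = ∼-trans }
                  ; ∙-cong = ∼-+-cong }
                ; assoc = λ x y z → ≈⇒∼ (+-assoc x y z) }
              ; identity = (λ x → ≈⇒∼ (+-identityˡ x)) , (λ x → ≈⇒∼ (+-identityʳ x)) }
            ; inverse = (λ x → ≈⇒∼ (-‿inverseˡ x)) , (λ x → ≈⇒∼ (-‿inverseʳ x))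
            ; ⁻¹-cong = ∼-‿cong }
          ; comm = λ x y → ≈⇒∼ (+-comm x y) }
        ; *-cong = ∼-*-cong
        ; *-assoc = λ x y z → ≈⇒∼ (*-assoc x y z)
        ; *-identity = (λ x → ≈⇒∼ (*-identityˡ x)) , (λ x → ≈⇒∼ (*-identityʳ x))
        ; distrib = (λ x y z → ≈⇒∼ (distribˡ x y z)) , (λ x y z → ≈⇒∼ (distribʳ x y z)) }
      ; *-comm = λ x y → ≈⇒∼ (*-comm x y) } }


∣-isIdeal : (k : ℤ) → IsIdeal ℤP.+-*-commutativeRing (k ∣ℤ_)
∣-isIdeal k = record
  { ∈-resp-≈  = ≡.subst (k ∣ℤ_)
  ; 0#∈       = divides (+ 0) (≡.sym (ℤP.*-zeroˡ k))
  ; +-closed  = ℤ∣.∣m∣n⇒∣m+n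
  ; *-closedˡ = ℤ∣.∣n⇒∣m*n
  }

module IntegersModPrime (p : ℕ) (p-prime : Prime p) where
  open import Data.Nat.Divisibility using (∣⇒≤)
  open import Data.Nat.Primality using (prime⇒nonZero; prime⇒nonTrivial)
  open import Data.Nat.Coprimality using (prime⇒coprime; coprime-Bézout)
  open import Data.Nat.GCD using (module Bézout)
  open import Data.Integer using (_%ℕ_; _/ℕ_)
  open import Data.Integer.DivMod using (a≡a%ℕn+[a/ℕn]*n; n%ℕd<d)
  open import Data.Integer.Tactic.RingSolver using (solve-∀)
  open import Relation.Nullary.Decidable using (map′)

  instance
    p≢0 : ℕ.NonZero p
    p≢0 = prime⇒nonZero p-prime

  open Quotient ℤP.+-*-commutativeRing (∣-isIdeal (+ p)) public
    using () renaming (quotientRing to ℤ/pℤ; _∼_ to _≡ₚ_)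
  open Quotient using (mk∼)
  open CommutativeRing ℤ/pℤ using (trans; *-congˡ)
  open Matrices ℤ/pℤ using (fromℕ; CharacteristicAbove)

  fromℕ≡+ : ∀ k → fromℕ k ≡ + k
  fromℕ≡+ zero    = ≡.refl
  fromℕ≡+ (suc k) = ≡.cong (λ z → + 1 ℤ.+ z) (fromℕ≡+ k)

  ≡ₚ0⇒∣ : ∀ {a} → a ≡ₚ + 0 → p ∣ ℤ.∣ a ∣
  ≡ₚ0⇒∣ {a} (mk∼ p∣a-0) = ∣⇒∣ᵤ (≡.subst (+ p ∣ℤ_) (ℤP.+-identityʳ a) p∣a-0)

  ≢0-below-p : ∀ {k} → 0 < k → k < p → ¬ (+ k ≡ₚ + 0)
  ≢0-below-p {suc k} _ k<p k≡0 = ℕP.<⇒≱ k<p (∣⇒≤ (≡ₚ0⇒∣ k≡0))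

  _≟0 : ∀ a → Dec (a ≡ₚ + 0)
  a ≟0 = map′ mk∼ _≡ₚ_.∈I ((+ p) ℤ∣.∣? (a ℤ.- + 0))

  1≢0 : ¬ (+ 1 ≡ₚ + 0)
  1≢0 = ≢0-below-p (s≤s z≤n) (ℕ.nonTrivial⇒n>1 p {{prime⇒nonTrivial p-prime}})

  characteristic : ∀ {n} → n < p → CharacteristicAbove n
  characteristic n<p k 0<k k≤n k≡0 = ≢0-below-p 0<k (ℕP.≤-<-trans k≤n n<p) (≡.subst (_≡ₚ + 0) (fromℕ≡+ k) k≡0)

  private
    +-homo : ∀ a b c → + (a ℕ.+ b ℕ.* c) ≡ + a ℤ.+ + b ℤ.* + c
    +-homo a b c = ≡.trans (ℤP.pos-+ a (b ℕ.* c)) (≡.cong (λ z → + a ℤ.+ z) (ℤP.pos-* b c))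

  inverse-below-p : ∀ {r} → 0 < r → r < p → ∃ λ u → u ℤ.* + r ≡ₚ + 1
  inverse-below-p {r@(suc _)} _ r<p with coprime-Bézout (prime⇒coprime p-prime r<p)
  ... | Bézout.+- x y 1+yr≡xp = ℤ.- + y , mk∼ (divides (ℤ.- + x) (begin
    ℤ.- + y ℤ.* + r ℤ.- + 1      ≡⟨ negate (+ y) (+ r) ⟩
    ℤ.- (+ 1 ℤ.+ + y ℤ.* + r)    ≡⟨ ≡.cong ℤ.-_ (+-homo 1 y r) ⟨
    ℤ.- + (1 ℕ.+ y ℕ.* r)        ≡⟨ ≡.cong (λ z → ℤ.- + z) 1+yr≡xp ⟩
    ℤ.- + (x ℕ.* p)              ≡⟨ ≡.cong ℤ.-_ (ℤP.pos-* x p) ⟩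
    ℤ.- (+ x ℤ.* + p)            ≡⟨ ℤP.neg-distribˡ-* (+ x) (+ p) ⟩
    ℤ.- + x ℤ.* + p              ∎))
    where
    open ≡.≡-Reasoning
    negate : ∀ y r → ℤ.- y ℤ.* r ℤ.- + 1 ≡ ℤ.- (+ 1 ℤ.+ y ℤ.* r)
    negate = solve-∀
  ... | Bézout.-+ x y 1+xp≡yr = + y , mk∼ (divides (+ x) (begin
    + y ℤ.* + r ℤ.- + 1          ≡⟨ ≡.cong (ℤ._- + 1) (ℤP.pos-* y r) ⟨
    + (y ℕ.* r) ℤ.- + 1          ≡⟨ ≡.cong (λ z → + z ℤ.- + 1) 1+xp≡yr ⟨
    + (1 ℕ.+ x ℕ.* p) ℤ.- + 1    ≡⟨ ≡.cong (ℤ._- + 1) (+-homo 1 x p) ⟩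
    + 1 ℤ.+ + x ℤ.* + p ℤ.- + 1  ≡⟨ cancel (+ 1) (+ x ℤ.* + p) ⟩
    + x ℤ.* + p                  ∎))
    where
    open ≡.≡-Reasoning
    cancel : ∀ a b → a ℤ.+ b ℤ.- a ≡ b
    cancel = solve-∀

  ≡ₚ-residue : ∀ a → a ≡ₚ + (a %ℕ p)
  ≡ₚ-residue a = mk∼ (divides (a /ℕ p) (begin
    a ℤ.- + (a %ℕ p)                                 ≡⟨ ≡.cong (ℤ._- + (a %ℕ p)) (a≡a%ℕn+[a/ℕn]*n a p) ⟩
    + (a %ℕ p) ℤ.+ (a /ℕ p) ℤ.* + p ℤ.- + (a %ℕ p)   ≡⟨ cancel (+ (a %ℕ p)) ((a /ℕ p) ℤ.* + p) ⟩
    (a /ℕ p) ℤ.* + p                                 ∎))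
    where
    open ≡.≡-Reasoning
    cancel : ∀ a b → a ℤ.+ b ℤ.- a ≡ b
    cancel = solve-∀

  inverse : ∀ {a} → ¬ (a ≡ₚ + 0) → ∃ λ u → u ℤ.* a ≡ₚ + 1
  inverse {a} a≢0 with a %ℕ p in a%p≡r
  ... | zero  = ⊥-elim (a≢0 (≡.subst (λ r → a ≡ₚ + r) a%p≡r (≡ₚ-residue a)))
  ... | suc r = let u , ur≡1 = inverse-below-p (s≤s z≤n) r<p in u , trans (*-congˡ {u} a≡r) ur≡1
    where
    a≡r : a ≡ₚ + suc r
    a≡r = ≡.subst (λ r → a ≡ₚ + r) a%p≡r (≡ₚ-residue a)
    r<p : suc r < p
    r<p = ≡.subst (_< p) a%p≡r (n%ℕd<d a p)

  ℤ/pℤ-isDiscreteField : IsDiscreteField ℤ/pℤ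
  ℤ/pℤ-isDiscreteField = record { _≟0 = _≟0 ; inverse = inverse ; 1≉0 = 1≢0 }

module Powers {c ℓ} (R : CommutativeRing c ℓ) where
  open CommutativeRing R
  open import Algebra.Properties.CommutativeSemigroup *-commutativeSemigroup using (interchange; x∙yz≈y∙xz)
  open import Relation.Binary.Reasoning.Setoid setoid

  pow-+ : ∀ x a b → pow R x (a ℕ.+ b) ≈ pow R x a * pow R x b
  pow-+ x zero    b = sym (*-identityˡ _)
  pow-+ x (suc a) b = trans (*-congˡ (pow-+ x a b)) (sym (*-assoc x _ _))

  pow-* : ∀ x y k → pow R (x * y) k ≈ pow R x k * pow R y k
  pow-* x y zero    = sym (*-identityʳ 1#)
  pow-* x y (suc k) = trans (*-congˡ (pow-* x y k)) (interchange x y (pow R x k) (pow R y k))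

  absorb-pow : ∀ {a y} → a ≈ a * y → ∀ t → a ≈ a * pow R y t
  absorb-pow {a} {y} a≈ay zero    = sym (*-identityʳ a)
  absorb-pow {a} {y} a≈ay (suc t) = begin
    a                   ≈⟨ a≈ay ⟩
    a * y               ≈⟨ *-congʳ (absorb-pow a≈ay t) ⟩
    a * pow R y t * y   ≈⟨ *-assoc a _ y ⟩
    a * (pow R y t * y) ≈⟨ *-congˡ (*-comm _ y) ⟩
    a * pow R y (suc t) ∎

  stable-power-idempotent : ∀ {x g} j → pow R x j ≈ pow R x j * (x * g) →
    let e = pow R (x * g) (suc j) in e * e ≈ e × pow R x j * e ≈ pow R x j
  stable-power-idempotent {x} {g} j stable = e*e≈e , sym xʲ≈xʲe
    where
    e = pow R (x * g) (suc j)
    h = x * pow R g (suc j)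

    xʲ≈xʲe : pow R x j ≈ pow R x j * e
    xʲ≈xʲe = absorb-pow stable (suc j)

    e≈xʲh : e ≈ pow R x j * h
    e≈xʲh = begin
      e                                     ≈⟨ pow-* x g (suc j) ⟩
      x * pow R x j * pow R g (suc j)        ≈⟨ *-congʳ (*-comm x (pow R x j)) ⟩
      pow R x j * x * pow R g (suc j)        ≈⟨ *-assoc (pow R x j) x _ ⟩
      pow R x j * h                         ∎

    e*e≈e : e * e ≈ e
    e*e≈e = begin
      e * e                 ≈⟨ *-congˡ e≈xʲh ⟩
      e * (pow R x j * h)   ≈⟨ *-assoc e (pow R x j) h ⟨
      e * pow R x j * h     ≈⟨ *-congʳ (*-comm e (pow R x j)) ⟩
      pow R x j * e * h     ≈⟨ *-congʳ xʲ≈xʲe ⟨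
      pow R x j * h         ≈⟨ e≈xʲh ⟨
      e                     ∎


module IntegerAction {c ℓ} (B : CommutativeRing c ℓ) where
  open import Data.Integer using (-[1+_]; _⊖_)
  open CommutativeRing B hiding (zero)
  open Matrices B using (sum; fromℕ; sum-cong-≋; ∑-sub; ∑-comm; *-distribˡ-sum; *-distribʳ-sum)
  open import Algebra.Properties.Ring ring using (-‿distribˡ-*; -‿involutive; -0#≈0#; [y-z]x≈yx-zx)
  open import Algebra.Properties.CommutativeSemigroup *-commutativeSemigroup using (x∙yz≈y∙xz)
  open import Algebra.Properties.AbelianGroup +-abelianGroup using (⁻¹-∙-comm)
  open import Algebra.Properties.CommutativeSemigroup +-commutativeSemigroup using (interchange)
  open import Algebra.Properties.Monoid.Mult +-monoid using (×-homo-+)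
  open import Relation.Binary.Reasoning.Setoid setoid

  ι : ℤ → Carrier
  ι = ιℤ B

  private
    shift-sub : ∀ x y → (1# + x) - (1# + y) ≈ x - y
    shift-sub x y = begin
      (1# + x) + - (1# + y)     ≈⟨ +-congˡ (⁻¹-∙-comm 1# y) ⟨
      (1# + x) + (- 1# + - y)   ≈⟨ interchange 1# x (- 1#) (- y) ⟩
      (1# - 1#) + (x - y)       ≈⟨ +-congʳ (-‿inverseʳ 1#) ⟩
      0# + (x - y)              ≈⟨ +-identityˡ (x - y) ⟩
      x - y                     ∎

  ι-⊖ : ∀ a b → ι (a ⊖ b) ≈ fromℕ a - fromℕ b
  ι-⊖ a       zero    = begin
    ι (a ⊖ 0)       ≡⟨⟩
    fromℕ a         ≈⟨ +-identityʳ (fromℕ a) ⟨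
    fromℕ a + 0#    ≈⟨ +-congˡ -0#≈0# ⟨
    fromℕ a - 0#    ∎
  ι-⊖ zero    (suc b) = sym (+-identityˡ _)
  ι-⊖ (suc a) (suc b) = begin
    ι (suc a ⊖ suc b)               ≡⟨ ≡.cong ι (ℤP.[1+m]⊖[1+n]≡m⊖n a b) ⟩
    ι (a ⊖ b)                       ≈⟨ ι-⊖ a b ⟩
    fromℕ a - fromℕ b               ≈⟨ shift-sub (fromℕ a) (fromℕ b) ⟨
    fromℕ (suc a) - fromℕ (suc b)   ∎

  ι-+ : ∀ z w → ι (z ℤ.+ w) ≈ ι z + ι w
  ι-+ (+ a)    (+ b)    = ×-homo-+ 1# a b
  ι-+ (+ a)    -[1+ b ] = ι-⊖ a (suc b)
  ι-+ -[1+ a ] (+ b)    = trans (ι-⊖ b (suc a)) (+-comm _ _)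
  ι-+ -[1+ a ] -[1+ b ] = begin
    - fromℕ (suc (suc (a ℕ.+ b)))        ≡⟨ ≡.cong (λ k → - fromℕ (suc k)) (ℕP.+-suc a b) ⟨
    - fromℕ (suc a ℕ.+ suc b)            ≈⟨ -‿cong (×-homo-+ 1# (suc a) (suc b)) ⟩
    - (fromℕ (suc a) + fromℕ (suc b))    ≈⟨ ⁻¹-∙-comm _ _ ⟨
    - fromℕ (suc a) + - fromℕ (suc b)    ∎

  ι-neg : ∀ z → ι (ℤ.- z) ≈ - ι z
  ι-neg (+ zero)  = sym -0#≈0#
  ι-neg (+ suc a) = refl
  ι-neg -[1+ a ]  = sym (-‿involutive _)

  ι-sub : ∀ z w → ι (z ℤ.- w) ≈ ι z - ι w
  ι-sub z w = trans (ι-+ z (ℤ.- w)) (+-congˡ (ι-neg w))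

  private
    ι-*ℕ : ∀ a w → ι (+ a ℤ.* w) ≈ fromℕ a * ι w
    ι-*ℕ zero    w = sym (zeroˡ (ι w))
    ι-*ℕ (suc a) w = begin
      ι (+ suc a ℤ.* w)
        ≡⟨ ≡.cong ι (≡.trans (ℤP.*-distribʳ-+ w (+ 1) (+ a)) (≡.cong (ℤ._+ (+ a ℤ.* w)) (ℤP.*-identityˡ w))) ⟩
      ι (w ℤ.+ + a ℤ.* w)           ≈⟨ ι-+ w (+ a ℤ.* w) ⟩
      ι w + ι (+ a ℤ.* w)           ≈⟨ +-cong (sym (*-identityˡ (ι w))) (ι-*ℕ a w) ⟩
      1# * ι w + fromℕ a * ι w      ≈⟨ distribʳ (ι w) 1# (fromℕ a) ⟨
      fromℕ (suc a) * ι w           ∎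

  ι-* : ∀ z w → ι (z ℤ.* w) ≈ ι z * ι w
  ι-* (+ a)    w = ι-*ℕ a w
  ι-* -[1+ a ] w = begin
    ι (-[1+ a ] ℤ.* w)              ≡⟨ ≡.cong ι (ℤP.neg-distribˡ-* (+ suc a) w) ⟨
    ι (ℤ.- (+ suc a ℤ.* w))         ≈⟨ ι-neg (+ suc a ℤ.* w) ⟩
    - ι (+ suc a ℤ.* w)             ≈⟨ -‿cong (ι-*ℕ (suc a) w) ⟩
    - (fromℕ (suc a) * ι w)         ≈⟨ -‿distribˡ-* _ _ ⟩
    - fromℕ (suc a) * ι w           ∎

  ι-1 : ι (+ 1) ≈ 1#
  ι-1 = +-identityʳ 1#

  ι-sum : ∀ {k} (f : Fin k → ℤ) → ι (sumℤ f) ≈ sum (λ i → ι (f i))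
  ι-sum {zero}  f = refl
  ι-sum {suc k} f = trans (ι-+ (f zero) (sumℤ (λ i → f (suc i)))) (+-congˡ (ι-sum (λ i → f (suc i))))

  lincomb-sub : ∀ {k} (a b : Fin k → ℤ) (w : Fin k → Carrier) →
    lincomb B (λ i → a i ℤ.- b i) w ≈ lincomb B a w - lincomb B b w
  lincomb-sub a b w = begin
    sum (λ i → ι (a i ℤ.- b i) * w i)              ≈⟨ sum-cong-≋ (λ i → trans (*-congʳ (ι-sub (a i) (b i))) ([y-z]x≈yx-zx (w i) _ _)) ⟩
    sum (λ i → ι (a i) * w i - ι (b i) * w i)      ≈⟨ ∑-sub (λ i → ι (a i) * w i) (λ i → ι (b i) * w i) ⟩
    lincomb B a w - lincomb B b w                  ∎

  *-lincomb : ∀ {k} (b : Carrier) (a : Fin k → ℤ) (w : Fin k → Carrier) →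
    b * lincomb B a w ≈ lincomb B a (λ i → b * w i)
  *-lincomb b a w = trans (*-distribˡ-sum b (λ i → ι (a i) * w i)) (sum-cong-≋ λ i → x∙yz≈y∙xz b (ι (a i)) (w i))

  lincomb-scale : ∀ {k} (z : ℤ) (a : Fin k → ℤ) (w : Fin k → Carrier) →
    lincomb B (λ i → z ℤ.* a i) w ≈ ι z * lincomb B a w
  lincomb-scale z a w = begin
    sum (λ i → ι (z ℤ.* a i) * w i)    ≈⟨ sum-cong-≋ (λ i → trans (*-congʳ (ι-* z (a i))) (*-assoc (ι z) (ι (a i)) (w i))) ⟩
    sum (λ i → ι z * (ι (a i) * w i))  ≈⟨ *-distribˡ-sum (ι z) (λ i → ι (a i) * w i) ⟨
    ι z * lincomb B a w                ∎

  lincomb-change-of-family : ∀ {k l} (a : Fin k → ℤ) {w : Fin k → Carrier} (W : Fin l → Fin k → ℤ) (u : Fin l → Carrier) →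
    (∀ i → w i ≈ lincomb B (λ r → W r i) u) → lincomb B a w ≈ lincomb B (λ r → sumℤ (λ i → W r i ℤ.* a i)) u
  lincomb-change-of-family a {w} W u w≈Wu = begin
    sum (λ i → ι (a i) * w i)
      ≈⟨ sum-cong-≋ (λ i → *-congˡ (w≈Wu i)) ⟩
    sum (λ i → ι (a i) * lincomb B (λ r → W r i) u)
      ≈⟨ sum-cong-≋ (λ i → *-lincomb (ι (a i)) (λ r → W r i) u) ⟩
    sum (λ i → sum (λ r → ι (W r i) * (ι (a i) * u r)))
      ≈⟨ ∑-comm (λ i r → ι (W r i) * (ι (a i) * u r)) ⟩
    sum (λ r → sum (λ i → ι (W r i) * (ι (a i) * u r)))
      ≈⟨ sum-cong-≋ (λ r → sum-cong-≋ λ i → trans (sym (*-assoc _ _ _)) (*-congʳ (sym (ι-* (W r i) (a i))))) ⟩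
    sum (λ r → sum (λ i → ι (W r i ℤ.* a i) * u r))
      ≈⟨ sum-cong-≋ (λ r → *-distribʳ-sum (u r) (λ i → ι (W r i ℤ.* a i))) ⟨
    sum (λ r → sum (λ i → ι (W r i ℤ.* a i)) * u r)
      ≈⟨ sum-cong-≋ (λ r → *-congʳ (ι-sum (λ i → W r i ℤ.* a i))) ⟨
    lincomb B (λ r → sumℤ (λ i → W r i ℤ.* a i)) u
      ∎


module Coordinates {c ℓ} (B : CommutativeRing c ℓ) {m n : ℕ} (β : FreeBasis B m n) (m·1≈0 : IsAlgebraOverZmod B m) where
  open CommutativeRing B hiding (zero)
  open FreeBasis β
  open IntegerAction B
  open import Algebra.Properties.Group +-group using (x≈y⇒x∙y⁻¹≈ε)

  coord-unique : ∀ {b} (a : Fin n → ℤ) → b ≈ lincomb B a e → ∀ r → (+ m) ∣ℤ (coord b r ℤ.- a r)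
  coord-unique {b} a b≈ae = λ r → ∣ᵤ⇒∣ (indep (λ r → coord b r ℤ.- a r) diff≈0 r)
    where
    diff≈0 : lincomb B (λ r → coord b r ℤ.- a r) e ≈ 0#
    diff≈0 = trans (lincomb-sub (coord b) a e) (x≈y⇒x∙y⁻¹≈ε (trans (sym (spans b)) b≈ae))

  coords-divisible⇒≈0 : ∀ b → (∀ r → (+ m) ℤᵤ.∣ coord b r) → b ≈ 0#
  coords-divisible⇒≈0 b m∣coord = trans (spans b) (sum-0 λ r → trans (*-congʳ (ι≈0 r)) (zeroˡ (e r)))
    where
    open Matrices B using (sum-0)
    ι≈0 : ∀ r → ι (coord b r) ≈ 0#
    ι≈0 r with divides q coord≡qm ← ∣ᵤ⇒∣ {+ m} {coord b r} (m∣coord r) =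
      trans (reflexive (≡.cong ι coord≡qm)) (trans (ι-* q (+ m)) (trans (*-congˡ m·1≈0) (zeroʳ (ι q))))

module ModuloPrime {c ℓ} (B : CommutativeRing c ℓ) {m n : ℕ} (β : FreeBasis B m n) (m·1≈0 : IsAlgebraOverZmod B m)
                   {p : ℕ} (p-prime : Prime p) (p∣m : p ∣ m) where
  open import Data.Product using (map₁; map₂)
  open import Data.Fin.Properties using (toℕ≤pred[n])
  open CommutativeRing B hiding (zero)
  open FreeBasis β
  open IntegerAction B
  open Coordinates B β m·1≈0
  open Powers B using (pow-*)
  open import Algebra.Properties.CommutativeSemigroup *-commutativeSemigroup using (x∙yz≈y∙xz)
  open IntegersModPrime p p-prime
  open Quotient using (mk∼)
  open LinearAlgebra ℤ/pℤ ℤ/pℤ-isDiscreteField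
  open Matrices ℤ/pℤ using (Matrix; _≋_; _⊗_; _⊗^_; 0M; 1M; ≋-trans; ≋-sym; ⊗-congˡ; tr; tr-cong)
  module ℤ/p = CommutativeRing ℤ/pℤ
  open import Algebra.Properties.Group ℤ/p.+-group using () renaming (x∙y⁻¹≈ε⇒x≈y to ≡ₚ-from-difference)

  pB : Carrier → Set (c ⊔ ℓ)
  pB b = ∃ λ u → b ≈ ι (+ p) * u

  pB-isIdeal : IsIdeal B pB
  pB-isIdeal = record
    { ∈-resp-≈  = λ { a≈b (u , a≈pu) → u , trans (sym a≈b) a≈pu }
    ; 0#∈       = 0# , sym (zeroʳ _)
    ; +-closed  = λ { (u , a≈pu) (v , b≈pv) → u + v , trans (+-cong a≈pu b≈pv) (sym (distribˡ _ u v)) }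
    ; *-closedˡ = λ { r (u , a≈pu) → r * u , trans (*-congˡ a≈pu) (x∙yz≈y∙xz r _ u) }
    }

  open Quotient B pB-isIdeal using (∼0⇒∈) renaming (≈⇒∼ to ≈⇒≈ₚ; quotientRing to B/pB; _∼_ to _≈ₚ_)
  module B/p = CommutativeRing B/pB
  open Powers B/pB using (stable-power-idempotent) renaming (pow-+ to B/p-pow-+)
  open import Algebra.Properties.Group B/p.+-group
    using () renaming (x≈y⇒x∙y⁻¹≈ε to ≈ₚ-difference; inverseˡ-unique to B/p-inverseˡ-unique)
  open import Algebra.Properties.Ring ring using (-‿distribʳ-*)

  m∣⇒≡ₚ : ∀ {a b} → (+ m) ∣ℤ (a ℤ.- b) → a ≡ₚ b
  m∣⇒≡ₚ m∣a-b = mk∼ (ℤ∣.∣-trans (∣ᵤ⇒∣ p∣m) m∣a-b)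

  m∣⇒≡ₚ0 : ∀ {a} → (+ m) ℤᵤ.∣ a → a ≡ₚ + 0
  m∣⇒≡ₚ0 {a} m∣a = m∣⇒≡ₚ (≡.subst ((+ m) ∣ℤ_) (≡.sym (ℤP.+-identityʳ a)) (∣ᵤ⇒∣ m∣a))

  ι-cong : ∀ {a b} → a ≡ₚ b → ι a ≈ₚ ι b
  ι-cong {a} {b} (mk∼ (divides q a-b≡qp)) = mk∼ (ι q , ιa-ιb≈pq)
    where
    open import Relation.Binary.Reasoning.Setoid setoid
    ιa-ιb≈pq : ι a - ι b ≈ ι (+ p) * ι q
    ιa-ιb≈pq = begin
      ι a - ι b             ≈⟨ ι-sub a b ⟨
      ι (a ℤ.- b)           ≡⟨ ≡.cong ι a-b≡qp ⟩
      ι (q ℤ.* + p)         ≈⟨ ι-* q (+ p) ⟩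
      ι q * ι (+ p)         ≈⟨ *-comm (ι q) _ ⟩
      ι (+ p) * ι q         ∎

  coord-lincomb : ∀ {b} (a : Fin n → ℤ) → b ≈ lincomb B a e → ∀ r → coord b r ≡ₚ a r
  coord-lincomb a b≈ae r = m∣⇒≡ₚ (coord-unique a b≈ae r)

  coord-≈ₚ0 : ∀ {b} → b ≈ₚ 0# → ∀ r → coord b r ≡ₚ + 0
  coord-≈ₚ0 {b} b≈0 r with u , b≈pu′ ← ∼0⇒∈ b≈0 =
    ℤ/p.trans (coord-lincomb (λ t → + p ℤ.* coord u t) b≈pu r) p·c≡0
    where
    b≈pu : b ≈ lincomb B (λ t → + p ℤ.* coord u t) e
    b≈pu = begin
      b                                       ≈⟨ b≈pu′ ⟩
      ι (+ p) * u                             ≈⟨ *-congˡ (spans u) ⟩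
      ι (+ p) * lincomb B (coord u) e         ≈⟨ lincomb-scale (+ p) (coord u) e ⟨
      lincomb B (λ t → + p ℤ.* coord u t) e   ∎
      where open import Relation.Binary.Reasoning.Setoid setoid
    p·c≡0 : + p ℤ.* coord u r ≡ₚ + 0
    p·c≡0 = mk∼ (divides (coord u r) (≡.trans (ℤP.+-identityʳ _) (ℤP.*-comm (+ p) (coord u r))))

  coord-cong : ∀ {a b} → a ≈ₚ b → ∀ r → coord a r ≡ₚ coord b r
  coord-cong {a} {b} a≈b r = ≡ₚ-from-difference (coord a r) (coord b r)
    (ℤ/p.trans (ℤ/p.sym (coord-lincomb (λ t → coord a t ℤ.- coord b t) a-b≈ r))
               (coord-≈ₚ0 (≈ₚ-difference a≈b) r))
    where
    a-b≈ : a - b ≈ lincomb B (λ t → coord a t ℤ.- coord b t) e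
    a-b≈ = trans (+-cong (spans a) (-‿cong (spans b))) (sym (lincomb-sub (coord a) (coord b) e))

  -- tr (mulMatrix b) is Tr B β b by definition: both sum coord (b * e i) i in ℤ.
  mulMatrix : Carrier → Matrix n n
  mulMatrix b i j = coord (b * e j) i

  mulMatrix-cong : ∀ {a b} → a ≈ₚ b → mulMatrix a ≋ mulMatrix b
  mulMatrix-cong a≈b i j = coord-cong (B/p.*-congʳ a≈b) i

  mulMatrix-≈ₚ0 : ∀ {b} → b ≈ₚ 0# → mulMatrix b ≋ 0M
  mulMatrix-≈ₚ0 b≈0 i j = coord-≈ₚ0 (B/p.trans (B/p.*-congʳ b≈0) (B/p.zeroˡ (e j))) i

  mulMatrix-* : ∀ b b′ → mulMatrix (b * b′) ≋ mulMatrix b ⊗ mulMatrix b′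
  mulMatrix-* b b′ i j = coord-lincomb (λ r → sumℤ (λ t → mulMatrix b r t ℤ.* mulMatrix b′ t j)) jth-column i
    where
    open import Relation.Binary.Reasoning.Setoid setoid
    jth-column : b * b′ * e j ≈ lincomb B (λ r → sumℤ (λ t → mulMatrix b r t ℤ.* mulMatrix b′ t j)) e
    jth-column = begin
      b * b′ * e j                                         ≈⟨ *-assoc b b′ (e j) ⟩
      b * (b′ * e j)                                       ≈⟨ *-congˡ (spans (b′ * e j)) ⟩
      b * lincomb B (λ t → mulMatrix b′ t j) e             ≈⟨ *-lincomb b (λ t → mulMatrix b′ t j) e ⟩
      lincomb B (λ t → mulMatrix b′ t j) (λ t → b * e t)
        ≈⟨ lincomb-change-of-family (λ t → mulMatrix b′ t j) (mulMatrix b) e (λ t → spans (b * e t)) ⟩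
      lincomb B (λ r → sumℤ (λ t → mulMatrix b r t ℤ.* mulMatrix b′ t j)) e ∎

  lincomb-≈ₚ0 : ∀ {k} (a : Fin k → ℤ) (w : Fin k → Carrier) → (∀ i → ι (a i) * w i ≈ₚ 0#) → lincomb B a w ≈ₚ 0#
  lincomb-≈ₚ0 a w = Matrices.sum-0 B/pB

  coords-≡ₚ0⇒≈ₚ0 : ∀ {b} → (∀ r → coord b r ≡ₚ + 0) → b ≈ₚ 0#
  coords-≡ₚ0⇒≈ₚ0 {b} coord≡0 = B/p.trans (≈⇒≈ₚ (spans b)) (lincomb-≈ₚ0 (coord b) e λ r →
    B/p.trans (B/p.*-congʳ (ι-cong (coord≡0 r))) (B/p.zeroˡ (e r)))

  mulMatrix-1 : mulMatrix 1# ≋ 1M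
  mulMatrix-1 i j = coord-lincomb (λ r → 1M r j) eⱼ≈ i
    where
    module MB = Matrices B
    ι-1M : ∀ {k} (r j : Fin k) → ι (1M r j) ≈ MB.1M j r
    ι-1M zero    zero    = ι-1
    ι-1M zero    (suc j) = refl
    ι-1M (suc r) zero    = refl
    ι-1M (suc r) (suc j) = ι-1M r j
    eⱼ≈ : 1# * e j ≈ lincomb B (λ r → 1M r j) e
    eⱼ≈ = trans (*-identityˡ (e j)) (trans (sym (MB.sum-1Mˡ j e)) (MB.sum-cong-≋ λ r → *-congʳ (sym (ι-1M r j))))

  mulMatrix-pow : ∀ z k → mulMatrix (pow B z k) ≋ mulMatrix z ⊗^ k
  mulMatrix-pow z zero    = mulMatrix-1
  mulMatrix-pow z (suc k) = ≋-trans (mulMatrix-* z (pow B z k)) (⊗-congˡ {A = mulMatrix z} (mulMatrix-pow z k))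

  mulMatrix≋0⇒≈ₚ0 : ∀ {b} → mulMatrix b ≋ 0M → b ≈ₚ 0#
  mulMatrix≋0⇒≈ₚ0 {b} Mb≋0 = B/p.trans (≈⇒≈ₚ b≈) (lincomb-≈ₚ0 (coord 1#) (λ t → b * e t) λ t →
    B/p.trans (B/p.*-congˡ (coords-≡ₚ0⇒≈ₚ0 λ r → Mb≋0 r t)) (B/p.zeroʳ _))
    where
    b≈ : b ≈ lincomb B (coord 1#) (λ t → b * e t)
    b≈ = trans (sym (*-identityʳ b)) (trans (*-congˡ (spans 1#)) (*-lincomb b (coord 1#) e))

  nilpotent⇒Tr≡ₚ0 : ∀ {x} k → pow B x k ≈ 0# → ∀ y → Tr B β (x * y) ≡ₚ + 0
  nilpotent⇒Tr≡ₚ0 {x} k xᵏ≈0 y = tr-nilpotent k (mulMatrix (x * y))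
    (≋-trans (≋-sym (mulMatrix-pow (x * y) k)) (mulMatrix-≈ₚ0 (≈⇒≈ₚ [xy]ᵏ≈0)))
    where
    [xy]ᵏ≈0 : pow B (x * y) k ≈ 0#
    [xy]ᵏ≈0 = trans (pow-* x y k) (trans (*-congʳ xᵏ≈0) (zeroˡ _))

  horner : ∀ {k} → (Fin k → ℤ) → Carrier → Carrier
  horner {zero}  a y = 0#
  horner {suc k} a y = ι (a zero) + y * horner (λ i → a (suc i)) y

  lincomb-powers : ∀ {k} (a : Fin k → ℤ) y → lincomb B a (λ i → pow B y (toℕ i)) ≈ horner a y
  lincomb-powers {zero}  a y = refl
  lincomb-powers {suc k} a y = +-cong (*-identityʳ (ι (a zero))) (begin
    lincomb B (λ i → a (suc i)) (λ i → y * pow B y (toℕ i))   ≈⟨ *-lincomb y (λ i → a (suc i)) (λ i → pow B y (toℕ i)) ⟨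
    y * lincomb B (λ i → a (suc i)) (λ i → pow B y (toℕ i))   ≈⟨ *-congˡ (lincomb-powers (λ i → a (suc i)) y) ⟩
    y * horner (λ i → a (suc i)) y                            ∎)
    where open import Relation.Binary.Reasoning.Setoid setoid

  private
    negate-inside : ∀ u X x h → u * - (X * (x * h)) ≈ X * (x * - (u * h))
    negate-inside u X x h = begin
      u * - (X * (x * h))      ≈⟨ -‿distribʳ-* u _ ⟨
      - (u * (X * (x * h)))    ≈⟨ -‿cong (trans (x∙yz≈y∙xz u X (x * h)) (*-congˡ (x∙yz≈y∙xz u x h))) ⟩
      - (X * (x * (u * h)))    ≈⟨ -‿distribʳ-* X _ ⟩
      X * - (x * (u * h))      ≈⟨ *-congˡ (-‿distribʳ-* x (u * h)) ⟩
      X * (x * - (u * h))      ∎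
      where open import Relation.Binary.Reasoning.Setoid setoid

  -- If a₀ ≡ 0 the relation is x times a shorter one; otherwise a₀ is a unit and we solve for xʲ.
  lowest-nonzero-term : ∀ {k} (a : Fin k → ℤ) {x} j (i : Fin k) → ¬ a i ≡ₚ + 0 → pow B/pB x j * horner a x ≈ₚ 0# →
    ∃ λ j′ → j′ ≤ j ℕ.+ toℕ i × ∃ λ g → pow B/pB x j′ ≈ₚ pow B/pB x j′ * (x * g)
  lowest-nonzero-term {suc k} a {x} j i aᵢ≢0 relation with a zero ≟0 | i
  ... | yes a₀≡0 | zero   = ⊥-elim (aᵢ≢0 a₀≡0)
  ... | yes a₀≡0 | suc i′ = map₂ (map₁ (λ j′≤ → ℕP.≤-trans j′≤ (ℕP.≤-reflexive (≡.sym (ℕP.+-suc j (toℕ i′))))))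
                             (lowest-nonzero-term (λ i → a (suc i)) (suc j) i′ aᵢ≢0 shifted)
    where
    open import Relation.Binary.Reasoning.Setoid B/p.setoid
    X = pow B/pB x j
    h = horner (λ i → a (suc i)) x
    shifted : pow B/pB x (suc j) * h ≈ₚ 0#
    shifted = begin
      x * X * h                ≈⟨ ≈⇒≈ₚ (trans (*-congʳ (*-comm x X)) (*-assoc X x h)) ⟩
      X * (x * h)              ≈⟨ B/p.*-congˡ (B/p.+-identityˡ (x * h)) ⟨
      X * (0# + x * h)         ≈⟨ B/p.*-congˡ (B/p.+-congʳ (ι-cong a₀≡0)) ⟨
      X * (ι (a zero) + x * h) ≈⟨ relation ⟩
      0#                       ∎
  ... | no a₀≢0 | i′ = j , ℕP.m≤m+n j (toℕ i′) , - (ι u * h) , stable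
    where
    open import Relation.Binary.Reasoning.Setoid B/p.setoid
    u = proj₁ (inverse a₀≢0)
    X = pow B/pB x j
    h = horner (λ i → a (suc i)) x
    ua₀≈1 : ι u * ι (a zero) ≈ₚ 1#
    ua₀≈1 = B/p.trans (≈⇒≈ₚ (sym (ι-* u (a zero)))) (B/p.trans (ι-cong (proj₂ (inverse a₀≢0))) (≈⇒≈ₚ ι-1))
    Xa₀≈ : X * ι (a zero) ≈ₚ - (X * (x * h))
    Xa₀≈ = B/p-inverseˡ-unique _ _ (B/p.trans (B/p.sym (B/p.distribˡ X (ι (a zero)) (x * h))) relation)
    stable : X ≈ₚ X * (x * - (ι u * h))
    stable = begin
      X                              ≈⟨ B/p.*-identityʳ X ⟨
      X * 1#                         ≈⟨ B/p.*-congˡ ua₀≈1 ⟨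
      X * (ι u * ι (a zero))         ≈⟨ ≈⇒≈ₚ (x∙yz≈y∙xz X (ι u) (ι (a zero))) ⟩
      ι u * (X * ι (a zero))         ≈⟨ B/p.*-congˡ Xa₀≈ ⟩
      ι u * - (X * (x * h))          ≈⟨ ≈⇒≈ₚ (negate-inside (ι u) X x h) ⟩
      X * (x * - (ι u * h))          ∎


  pow-B/pB : ∀ x k → pow B/pB x k ≡ pow B x k
  pow-B/pB x zero    = ≡.refl
  pow-B/pB x (suc k) = ≡.cong (x *_) (pow-B/pB x k)

  powers-dependent : n < p → ∀ x → ∃ λ (a : Fin (suc n) → ℤ) → (∃ λ i → ¬ a i ≡ₚ + 0) × horner a x ≈ₚ 0#
  powers-dependent n<p x = dependence (wide-kernel (characteristic n<p) W)
    where
    W : Matrix n (suc n)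
    W r i = coord (pow B x (toℕ i)) r
    horner≈0 : ∀ {a} → (∀ r → (W ⊗ᵛ a) r ≡ₚ + 0) → horner a x ≈ₚ 0#
    horner≈0 {a} Wa≡0 = begin
      horner a x                                         ≈⟨ ≈⇒≈ₚ (lincomb-powers a x) ⟨
      lincomb B a (λ i → pow B x (toℕ i))
        ≈⟨ ≈⇒≈ₚ (lincomb-change-of-family a W e (λ i → spans (pow B x (toℕ i)))) ⟩
      lincomb B (λ r → sumℤ (λ i → W r i ℤ.* a i)) e
        ≈⟨ lincomb-≈ₚ0 (λ r → sumℤ (λ i → W r i ℤ.* a i)) e
                       (λ r → B/p.trans (B/p.*-congʳ (ι-cong (Wa≡0 r))) (B/p.zeroˡ (e r))) ⟩
      0#                                                 ∎
      where open import Relation.Binary.Reasoning.Setoid B/p.setoid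
    dependence : NonTrivialKernel W → ∃ λ (a : Fin (suc n) → ℤ) → (∃ λ i → ¬ a i ≡ₚ + 0) × horner a x ≈ₚ 0#
    dependence (a , a≢0 , Wa≡0) = a , a≢0 , horner≈0 {a} Wa≡0

  stable-power : n < p → ∀ x → ∃ λ j → j ≤ n × ∃ λ g → pow B/pB x j ≈ₚ pow B/pB x j * (x * g)
  stable-power n<p x = from-dependence (powers-dependent n<p x)
    where
    from-dependence : (∃ λ (a : Fin (suc n) → ℤ) → (∃ λ i → ¬ a i ≡ₚ + 0) × horner a x ≈ₚ 0#) →
                      ∃ λ j → j ≤ n × ∃ λ g → pow B/pB x j ≈ₚ pow B/pB x j * (x * g)
    from-dependence (a , (i , aᵢ≢0) , horner≈0)
      with j , j≤i , stable ← lowest-nonzero-term a 0 i aᵢ≢0 (B/p.trans (B/p.*-identityˡ (horner a x)) horner≈0)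
      = j , ℕP.≤-trans j≤i (toℕ≤pred[n] i) , stable

  idempotent-Tr≡0⇒≈ₚ0 : n < p → ∀ {e} → e * e ≈ₚ e → Tr B β e ≡ₚ + 0 → e ≈ₚ 0#
  idempotent-Tr≡0⇒≈ₚ0 n<p {e} e²≈e Tr≡0 = mulMatrix≋0⇒≈ₚ0
    (idempotent-tr≈0⇒≋0 (characteristic n<p) (≋-trans (≋-sym (mulMatrix-* e e)) (mulMatrix-cong e²≈e)) Tr≡0)

  trad⇒xⁿ≈ₚ0 : n < p → ∀ {x} → InTrad B β x → pow B x n ≈ₚ 0#
  trad⇒xⁿ≈ₚ0 n<p {x} x∈Trad = conclude (stable-power n<p x)
    where
    conclude : (∃ λ j → j ≤ n × ∃ λ g → pow B/pB x j ≈ₚ pow B/pB x j * (x * g)) → pow B x n ≈ₚ 0#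
    conclude (j , j≤n , g , stable) = begin
      pow B x n                               ≡⟨ pow-B/pB x n ⟨
      pow B/pB x n                            ≡⟨ ≡.cong (pow B/pB x) (ℕP.m∸n+n≡m j≤n) ⟨
      pow B/pB x (n ℕ.∸ j ℕ.+ j)              ≈⟨ B/p-pow-+ x (n ℕ.∸ j) j ⟩
      pow B/pB x (n ℕ.∸ j) * pow B/pB x j     ≈⟨ B/p.*-congˡ xʲ≈0 ⟩
      pow B/pB x (n ℕ.∸ j) * 0#               ≈⟨ B/p.zeroʳ _ ⟩
      0#                                      ∎
      where
      open import Relation.Binary.Reasoning.Setoid B/p.setoid
      ε = pow B/pB (x * g) (suc j)
      idempotent = stable-power-idempotent j stable
      Tr-ε≡0 : Tr B β ε ≡ₚ + 0
      Tr-ε≡0 = ℤ/p.trans (tr-cong (mulMatrix-cong (≈⇒≈ₚ (*-assoc x g _))))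
                         (m∣⇒≡ₚ0 (x∈Trad (g * pow B/pB (x * g) j)))
      xʲ≈0 : pow B/pB x j ≈ₚ 0#
      xʲ≈0 = B/p.trans (B/p.sym (proj₂ idempotent))
               (B/p.trans (B/p.*-congˡ (idempotent-Tr≡0⇒≈ₚ0 n<p (proj₁ idempotent) Tr-ε≡0)) (B/p.zeroʳ _))


squarefree-∣ : ∀ {m} → 0 < m → SquareFree m → ∀ t → (∀ p → Prime p → p ∣ m → p ∣ t) → m ∣ t
squarefree-∣ {m} 0<m sf t p∣⇒p∣t = ≡.subst (_∣ t) (≡.sym m≡∏) (product-∣ factorsPrime (≡.subst SquareFree m≡∏ sf)
  λ p p-prime → p∣⇒p∣t p p-prime ∘ ≡.subst (p ∣_) (≡.sym m≡∏))
  where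
  open import Data.Nat using (NonZero; >-nonZero)
  open import Data.Nat.Divisibility using (divides; 1∣_; ∣n⇒∣m*n; m∣m*n; *-monoʳ-∣)
  open import Data.Nat.Primality using (euclidsLemma)
  open import Data.Nat.Primality.Factorisation using (factorise; PrimeFactorisation)
  open import Data.Nat.ListAction using (product)
  open import Data.List using ([]; _∷_)
  open import Data.List.Relation.Unary.All using (All; []; _∷_)
  open import Data.Sum using (inj₁; inj₂)
  open import Function using (_∘_)

  instance
    m≢0 : NonZero m
    m≢0 = >-nonZero 0<m
  open PrimeFactorisation (factorise m) renaming (isFactorisation to m≡∏)

  product-∣ : ∀ {ps} → All Prime ps → SquareFree (product ps) → (∀ p → Prime p → p ∣ product ps → p ∣ t) → product ps ∣ t
  product-∣ [] _ _ = 1∣ t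
  product-∣ {q ∷ ps} (q-prime ∷ ps-prime) sf p∣⇒p∣t
    with divides s t≡s·ps ← product-∣ ps-prime (λ p p-prime → sf p p-prime ∘ ∣n⇒∣m*n q)
                                              (λ p p-prime → p∣⇒p∣t p p-prime ∘ ∣n⇒∣m*n q)
    with euclidsLemma s (product ps) q-prime (≡.subst (q ∣_) t≡s·ps (p∣⇒p∣t q q-prime (m∣m*n (product ps))))
  ... | inj₁ (divides s′ s≡s′q) =
    divides s′ (≡.trans t≡s·ps (≡.trans (≡.cong (ℕ._* product ps) s≡s′q) (ℕP.*-assoc s′ q (product ps))))
  ... | inj₂ q∣ps = ⊥-elim (sf q q-prime (*-monoʳ-∣ q q∣ps))

proposition5p20 : ∀ {c ℓ} (B : CommutativeRing c ℓ) (m n : ℕ)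
    → 0 < m → SquareFree m
    → IsAlgebraOverZmod B m
    → (β : FreeBasis B m n)
    → (∀ p → Prime p → p ∣ m → n < p)
    → ∀ x → (InTrad B β x → IsNilpotent B x) × (IsNilpotent B x → InTrad B β x)
proposition5p20 B m n 0<m sf m·1≈0 β n<p x = trad⇒nilpotent , nilpotent⇒trad
  where
  open Coordinates B β m·1≈0 using (coords-divisible⇒≈0)
  module Mod {p} (p-prime : Prime p) (p∣m : p ∣ m) = ModuloPrime B β m·1≈0 p-prime p∣m

  divisible-mod-primes : ∀ z → (∀ {p} (p-prime : Prime p) → p ∣ m → IntegersModPrime._≡ₚ_ p p-prime z (+ 0)) →
                         (+ m) ℤᵤ.∣ z
  divisible-mod-primes z z≡0 =
    squarefree-∣ 0<m sf ℤ.∣ z ∣ λ p p-prime p∣m → IntegersModPrime.≡ₚ0⇒∣ p p-prime (z≡0 p-prime p∣m)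

  nilpotent⇒trad : IsNilpotent B x → InTrad B β x
  nilpotent⇒trad (k , xᵏ≈0) y = divisible-mod-primes _ λ p-prime p∣m → Mod.nilpotent⇒Tr≡ₚ0 p-prime p∣m k xᵏ≈0 y

  trad⇒nilpotent : InTrad B β x → IsNilpotent B x
  trad⇒nilpotent x∈Trad = n , coords-divisible⇒≈0 (pow B x n) λ r → divisible-mod-primes _ λ p-prime p∣m →
    Mod.coord-≈ₚ0 p-prime p∣m (Mod.trad⇒xⁿ≈ₚ0 p-prime p∣m (n<p _ p-prime p∣m) x∈Trad) r
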